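{- Let $D$ be a square-free positive integer, $M=\mathbb{Q}(\sqrt{ -D})$ with ring of integers $\mathbb{Z}_M$, $c\in\mathbb{Z}_M$, $c\neq0$, and $\epsilon\in\mathbb{Z}_M$ a unit. Define $u_0=\epsilon,\ u_1=\epsilon(2c+1),\ u_{m+2}=(2c+2)u_{m+1}-u_m$ $(m\ge0)$ and $u'_0=\epsilon,\ u'_1=\epsilon(2c-1),\ u'_{n+2}=(2c-2)u'_{n+1}-u'_n$ $(n\ge0)$. Then for all $m,n\ge0$, $u_m\equiv\epsilon(1+m(m+1)c)\pmod{4c^2}$ and $u'_n\equiv(-1)^n\epsilon(1-n(n+1)c)\pmod{4c^2}$.
   Context: For $a,b,d\in\mathbb{Z}_M$ with $d\ne0$, $a\equiv b\pmod d$ means $a-b=dx$ for some $x\in\mathbb{Z}_M$. -}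

module Defs where

open import Data.Nat as ℕ using (ℕ; zero; suc; _%_; _/_)
open import Data.Nat.Divisibility as ℕD using ()
open import Data.Integer as ℤ using (ℤ; +_; -_)
open import Data.Product using (Σ; _×_; _,_)
open import Relation.Nullary using (¬_; yes; no)
open import Relation.Binary.PropositionalEquality using (_≡_)

SquareFree : ℕ → Set
SquareFree D = ∀ k → (k ℕ.* k) ℕD.∣ D → k ≡ 1

-- Ring of integers Z_M of M = Q(√-D) (D square-free, positive), as Z[ω] with
--   ω = √-D          if D ≢ 3 (mod 4)   (so ω² = -D)
--   ω = (1+√-D)/2    if D ≡ 3 (mod 4)   (so ω² = ω - (1+D)/4)
-- An element re + im·ω is stored as the pair (re , im).
record ZM (D : ℕ) : Set where
  constructor mk
  field
    re : ℤ
    im : ℤ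

-- ω² = p + q ω ; returns (p , q)
ωsq : ℕ → ℤ × ℤ
ωsq D with D % 4 ℕ.≟ 3
... | yes _ = (- (+ (D / 4 ℕ.+ 1)) , + 1)   -- D = 4k+3 : (1+D)/4 = k+1
... | no  _ = (- (+ D) , + 0)

module _ {D : ℕ} where
  infixl 6 _+ᴹ_ _-ᴹ_
  infixl 7 _*ᴹ_

  _+ᴹ_ : ZM D → ZM D → ZM D
  mk a b +ᴹ mk c d = mk (a ℤ.+ c) (b ℤ.+ d)

  -ᴹ_ : ZM D → ZM D
  -ᴹ mk a b = mk (- a) (- b)

  _-ᴹ_ : ZM D → ZM D → ZM D
  x -ᴹ y = x +ᴹ (-ᴹ y)

  _*ᴹ_ : ZM D → ZM D → ZM D
  mk a b *ᴹ mk c d with ωsq D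
  ... | (p , q) = mk (a ℤ.* c ℤ.+ b ℤ.* d ℤ.* p)
                     (a ℤ.* d ℤ.+ b ℤ.* c ℤ.+ b ℤ.* d ℤ.* q)

  0ᴹ 1ᴹ : ZM D
  0ᴹ = mk (+ 0) (+ 0)
  1ᴹ = mk (+ 1) (+ 0)

  ι : ℤ → ZM D
  ι z = mk z (+ 0)

  IsUnit : ZM D → Set
  IsUnit ε = Σ (ZM D) λ v → ε *ᴹ v ≡ 1ᴹ

  _≡_[mod_] : ZM D → ZM D → ZM D → Set
  a ≡ b [mod d ] = ¬ (d ≡ 0ᴹ) × Σ (ZM D) λ x → a -ᴹ b ≡ d *ᴹ x

  u : ZM D → ZM D → ℕ → ZM D
  u ε c zero = ε
  u ε c (suc zero) = ε *ᴹ (ι (+ 2) *ᴹ c +ᴹ 1ᴹ)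
  u ε c (suc (suc m)) = (ι (+ 2) *ᴹ c +ᴹ ι (+ 2)) *ᴹ u ε c (suc m) -ᴹ u ε c m

  u′ : ZM D → ZM D → ℕ → ZM D
  u′ ε c zero = ε
  u′ ε c (suc zero) = ε *ᴹ (ι (+ 2) *ᴹ c -ᴹ 1ᴹ)
  u′ ε c (suc (suc n)) = (ι (+ 2) *ᴹ c -ᴹ ι (+ 2)) *ᴹ u′ ε c (suc n) -ᴹ u′ ε c n

  sgn : ℕ → ZM D
  sgn zero = 1ᴹ
  sgn (suc n) = -ᴹ sgn n

module Submission where

open import Defs
open import Data.Nat using (ℕ; zero; suc; _>_)
import Data.Nat as ℕ
import Data.Nat.Properties as ℕP
import Data.Nat.Tactic.RingSolver as ℕSolver
open import Data.Integer as ℤ using (ℤ; +_; -_)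
import Data.Integer.Properties as ℤP
open import Data.Integer.Tactic.RingSolver using (solve-∀)
open import Data.Product using (Σ; _×_; _,_; proj₁; proj₂)
open import Data.Sum using ([_,_]′; inj₁; inj₂)
open import Data.Maybe using (Maybe; just; nothing)
open import Function using (id)
open import Relation.Nullary using (¬_; yes; no; contradiction)
open import Relation.Binary.PropositionalEquality
open import Level using (0ℓ)
open import Algebra.Bundles using (CommutativeRing)
open import Algebra.Structures using (IsCommutativeRing)
open import Algebra.Solver.Ring.AlmostCommutativeRing
  using (fromCommutativeRing; _-Raw-AlmostCommutative⟶_)

-- 1. Z_M is a commutative ring

module QuadraticRing (D : ℕ) where

  +ᴹ-assoc : ∀ (x y z : ZM D) → (x +ᴹ y) +ᴹ z ≡ x +ᴹ (y +ᴹ z)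
  +ᴹ-assoc (mk a b) (mk c d) (mk e f) = cong₂ mk (ℤP.+-assoc a c e) (ℤP.+-assoc b d f)

  +ᴹ-comm : ∀ (x y : ZM D) → x +ᴹ y ≡ y +ᴹ x
  +ᴹ-comm (mk a b) (mk c d) = cong₂ mk (ℤP.+-comm a c) (ℤP.+-comm b d)

  +ᴹ-identityˡ : ∀ (x : ZM D) → 0ᴹ +ᴹ x ≡ x
  +ᴹ-identityˡ (mk a b) = cong₂ mk (ℤP.+-identityˡ a) (ℤP.+-identityˡ b)

  +ᴹ-identityʳ : ∀ (x : ZM D) → x +ᴹ 0ᴹ ≡ x
  +ᴹ-identityʳ (mk a b) = cong₂ mk (ℤP.+-identityʳ a) (ℤP.+-identityʳ b)

  -ᴹ-inverseˡ : ∀ (x : ZM D) → (-ᴹ x) +ᴹ x ≡ 0ᴹ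
  -ᴹ-inverseˡ (mk a b) = cong₂ mk (ℤP.+-inverseˡ a) (ℤP.+-inverseˡ b)

  -ᴹ-inverseʳ : ∀ (x : ZM D) → x +ᴹ (-ᴹ x) ≡ 0ᴹ
  -ᴹ-inverseʳ (mk a b) = cong₂ mk (ℤP.+-inverseʳ a) (ℤP.+-inverseʳ b)

  *ᴹ-assoc : ∀ (x y z : ZM D) → (x *ᴹ y) *ᴹ z ≡ x *ᴹ (y *ᴹ z)
  *ᴹ-assoc (mk a b) (mk c d) (mk e f) with ωsq D
  ... | (p , q) = cong₂ mk (re a b c d e f p q) (im a b c d e f p q)
    where
    re : ∀ a b c d e f p q →
      (a ℤ.* c ℤ.+ b ℤ.* d ℤ.* p) ℤ.* e ℤ.+ (a ℤ.* d ℤ.+ b ℤ.* c ℤ.+ b ℤ.* d ℤ.* q) ℤ.* f ℤ.* p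
      ≡ a ℤ.* (c ℤ.* e ℤ.+ d ℤ.* f ℤ.* p) ℤ.+ b ℤ.* (c ℤ.* f ℤ.+ d ℤ.* e ℤ.+ d ℤ.* f ℤ.* q) ℤ.* p
    re = solve-∀
    im : ∀ a b c d e f p q →
      (a ℤ.* c ℤ.+ b ℤ.* d ℤ.* p) ℤ.* f ℤ.+ (a ℤ.* d ℤ.+ b ℤ.* c ℤ.+ b ℤ.* d ℤ.* q) ℤ.* e
        ℤ.+ (a ℤ.* d ℤ.+ b ℤ.* c ℤ.+ b ℤ.* d ℤ.* q) ℤ.* f ℤ.* q
      ≡ a ℤ.* (c ℤ.* f ℤ.+ d ℤ.* e ℤ.+ d ℤ.* f ℤ.* q) ℤ.+ b ℤ.* (c ℤ.* e ℤ.+ d ℤ.* f ℤ.* p)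
        ℤ.+ b ℤ.* (c ℤ.* f ℤ.+ d ℤ.* e ℤ.+ d ℤ.* f ℤ.* q) ℤ.* q
    im = solve-∀

  *ᴹ-comm : ∀ (x y : ZM D) → x *ᴹ y ≡ y *ᴹ x
  *ᴹ-comm (mk a b) (mk c d) with ωsq D
  ... | (p , q) = cong₂ mk (re a b c d p) (im a b c d q)
    where
    re : ∀ a b c d p → a ℤ.* c ℤ.+ b ℤ.* d ℤ.* p ≡ c ℤ.* a ℤ.+ d ℤ.* b ℤ.* p
    re = solve-∀
    im : ∀ a b c d q →
      a ℤ.* d ℤ.+ b ℤ.* c ℤ.+ b ℤ.* d ℤ.* q ≡ c ℤ.* b ℤ.+ d ℤ.* a ℤ.+ d ℤ.* b ℤ.* q
    im = solve-∀

  *ᴹ-identityˡ : ∀ (x : ZM D) → 1ᴹ *ᴹ x ≡ x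
  *ᴹ-identityˡ (mk a b) with ωsq D
  ... | (p , q) = cong₂ mk (re a b p) (im a b q)
    where
    re : ∀ a b p → + 1 ℤ.* a ℤ.+ + 0 ℤ.* b ℤ.* p ≡ a
    re = solve-∀
    im : ∀ a b q → + 1 ℤ.* b ℤ.+ + 0 ℤ.* a ℤ.+ + 0 ℤ.* b ℤ.* q ≡ b
    im = solve-∀

  *ᴹ-identityʳ : ∀ (x : ZM D) → x *ᴹ 1ᴹ ≡ x
  *ᴹ-identityʳ x = trans (*ᴹ-comm x 1ᴹ) (*ᴹ-identityˡ x)

  *ᴹ-distribˡ : ∀ (x y z : ZM D) → x *ᴹ (y +ᴹ z) ≡ x *ᴹ y +ᴹ x *ᴹ z
  *ᴹ-distribˡ (mk a b) (mk c d) (mk e f) with ωsq D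
  ... | (p , q) = cong₂ mk (re a b c d e f p) (im a b c d e f q)
    where
    re : ∀ a b c d e f p →
      a ℤ.* (c ℤ.+ e) ℤ.+ b ℤ.* (d ℤ.+ f) ℤ.* p
      ≡ (a ℤ.* c ℤ.+ b ℤ.* d ℤ.* p) ℤ.+ (a ℤ.* e ℤ.+ b ℤ.* f ℤ.* p)
    re = solve-∀
    im : ∀ a b c d e f q →
      a ℤ.* (d ℤ.+ f) ℤ.+ b ℤ.* (c ℤ.+ e) ℤ.+ b ℤ.* (d ℤ.+ f) ℤ.* q
      ≡ (a ℤ.* d ℤ.+ b ℤ.* c ℤ.+ b ℤ.* d ℤ.* q) ℤ.+ (a ℤ.* f ℤ.+ b ℤ.* e ℤ.+ b ℤ.* f ℤ.* q)
    im = solve-∀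

  *ᴹ-distribʳ : ∀ (x y z : ZM D) → (y +ᴹ z) *ᴹ x ≡ y *ᴹ x +ᴹ z *ᴹ x
  *ᴹ-distribʳ x y z = begin
    (y +ᴹ z) *ᴹ x       ≡⟨ *ᴹ-comm (y +ᴹ z) x ⟩
    x *ᴹ (y +ᴹ z)       ≡⟨ *ᴹ-distribˡ x y z ⟩
    x *ᴹ y +ᴹ x *ᴹ z    ≡⟨ cong₂ _+ᴹ_ (*ᴹ-comm x y) (*ᴹ-comm x z) ⟩
    y *ᴹ x +ᴹ z *ᴹ x    ∎
    where open ≡-Reasoning

  isCommutativeRing : IsCommutativeRing _≡_ _+ᴹ_ _*ᴹ_ (λ x → -ᴹ x) 0ᴹ 1ᴹ
  isCommutativeRing = record
    { isRing = record
      { +-isAbelianGroup = record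
        { isGroup = record
          { isMonoid = record
            { isSemigroup = record
              { isMagma = record { isEquivalence = isEquivalence ; ∙-cong = cong₂ _+ᴹ_ }
              ; assoc = +ᴹ-assoc }
            ; identity = +ᴹ-identityˡ , +ᴹ-identityʳ }
          ; inverse = -ᴹ-inverseˡ , -ᴹ-inverseʳ
          ; ⁻¹-cong = cong (λ x → -ᴹ x) }
        ; comm = +ᴹ-comm }
      ; *-cong = cong₂ _*ᴹ_
      ; *-assoc = *ᴹ-assoc
      ; *-identity = *ᴹ-identityˡ , *ᴹ-identityʳ
      ; distrib = *ᴹ-distribˡ , *ᴹ-distribʳ }
    ; *-comm = *ᴹ-comm }

  commutativeRing : CommutativeRing 0ℓ 0ℓ
  commutativeRing = record { isCommutativeRing = isCommutativeRing }

  ι-scale : ∀ k a b → ι k *ᴹ mk a b ≡ mk {D} (k ℤ.* a) (k ℤ.* b)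
  ι-scale k a b with ωsq D
  ... | (p , q) = cong₂ mk (re k a b p) (im k a b q)
    where
    re : ∀ k a b p → k ℤ.* a ℤ.+ + 0 ℤ.* b ℤ.* p ≡ k ℤ.* a
    re = solve-∀
    im : ∀ k a b q → k ℤ.* b ℤ.+ + 0 ℤ.* a ℤ.+ + 0 ℤ.* b ℤ.* q ≡ k ℤ.* b
    im = solve-∀

  ι-* : ∀ a b → ι (a ℤ.* b) ≡ ι a *ᴹ ι b
  ι-* a b = trans (cong (mk {D} (a ℤ.* b)) (sym (ℤP.*-zeroʳ a))) (sym (ι-scale a b (+ 0)))

  ι-morphism : ℤ.+-*-rawRing -Raw-AlmostCommutative⟶ fromCommutativeRing commutativeRing
  ι-morphism = record
    { ⟦_⟧ = ι
    ; +-homo = λ _ _ → refl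
    ; *-homo = ι-*
    ; -‿homo = λ _ → refl
    ; 0-homo = refl
    ; 1-homo = refl }

  ι-equal? : ∀ a b → Maybe (ι {D} a ≡ ι b)
  ι-equal? a b with a ℤ.≟ b
  ... | yes refl = just refl
  ... | no _ = nothing

  open import Algebra.Solver.Ring ℤ.+-*-rawRing (fromCommutativeRing commutativeRing)
    ι-morphism ι-equal? public

-- 2. The modulus 4c² is nonzero

discriminant : ℤ × ℤ → ℤ
discriminant (p , q) = q ℤ.* q ℤ.+ + 4 ℤ.* p

-- With s = 2a + bq the ω-part of the square is b s and four times the
-- rational part is s (s - 2bq) + b² (q² + 4p); so b = 0 or s = 0, and in
-- the latter case b² (q² + 4p) = 0, whence again b = 0, and then a² = 0.
square-zero-coordinates : ∀ p q a b → discriminant (p , q) ≢ + 0 →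
  a ℤ.* a ℤ.+ b ℤ.* b ℤ.* p ≡ + 0 →
  a ℤ.* b ℤ.+ b ℤ.* a ℤ.+ b ℤ.* b ℤ.* q ≡ + 0 →
  a ≡ + 0 × b ≡ + 0
square-zero-coordinates p q a b Δ≢0 re≡0 im≡0 = a≡0 , b≡0
  where
  square≡0 : ∀ x → x ℤ.* x ≡ + 0 → x ≡ + 0
  square≡0 x eq = [ id , id ]′ (ℤP.i*j≡0⇒i≡0∨j≡0 x eq)

  s : ℤ
  s = + 2 ℤ.* a ℤ.+ b ℤ.* q

  im-factors : b ℤ.* s ≡ a ℤ.* b ℤ.+ b ℤ.* a ℤ.+ b ℤ.* b ℤ.* q
  im-factors = identity a b q
    where
    identity : ∀ a b q → b ℤ.* (+ 2 ℤ.* a ℤ.+ b ℤ.* q) ≡ a ℤ.* b ℤ.+ b ℤ.* a ℤ.+ b ℤ.* b ℤ.* q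
    identity = solve-∀

  re-completed : b ℤ.* b ℤ.* (q ℤ.* q ℤ.+ + 4 ℤ.* p)
               ≡ + 4 ℤ.* (a ℤ.* a ℤ.+ b ℤ.* b ℤ.* p) ℤ.- s ℤ.* (s ℤ.- + 2 ℤ.* b ℤ.* q)
  re-completed = identity a b p q
    where
    identity : ∀ a b p q → b ℤ.* b ℤ.* (q ℤ.* q ℤ.+ + 4 ℤ.* p)
      ≡ + 4 ℤ.* (a ℤ.* a ℤ.+ b ℤ.* b ℤ.* p)
        ℤ.- (+ 2 ℤ.* a ℤ.+ b ℤ.* q) ℤ.* ((+ 2 ℤ.* a ℤ.+ b ℤ.* q) ℤ.- + 2 ℤ.* b ℤ.* q)
    identity = solve-∀

  b≡0 : b ≡ + 0
  b≡0 with ℤP.i*j≡0⇒i≡0∨j≡0 b (trans im-factors im≡0)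
  ... | inj₁ b≡0 = b≡0
  ... | inj₂ s≡0 = square≡0 b b²≡0
    where
    b²Δ≡0 : b ℤ.* b ℤ.* (q ℤ.* q ℤ.+ + 4 ℤ.* p) ≡ + 0
    b²Δ≡0 = trans re-completed
      (cong₂ (λ r t → + 4 ℤ.* r ℤ.- t ℤ.* (s ℤ.- + 2 ℤ.* b ℤ.* q)) re≡0 s≡0)
    b²≡0 : b ℤ.* b ≡ + 0
    b²≡0 = [ id , (λ Δ≡0 → contradiction Δ≡0 Δ≢0) ]′ (ℤP.i*j≡0⇒i≡0∨j≡0 (b ℤ.* b) b²Δ≡0)

  a≡0 : a ≡ + 0
  a≡0 = square≡0 a (trans (sym (a²-part a p))
    (subst (λ b → a ℤ.* a ℤ.+ b ℤ.* b ℤ.* p ≡ + 0) b≡0 re≡0))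
    where
    a²-part : ∀ a p → a ℤ.* a ℤ.+ + 0 ℤ.* + 0 ℤ.* p ≡ a ℤ.* a
    a²-part = solve-∀

-- 1 + 4p is odd, hence nonzero.
one-plus-four-times≢0 : ∀ p → + 1 ℤ.+ + 4 ℤ.* p ≢ + 0
one-plus-four-times≢0 p eq = contradiction four≡1 λ ()
  where
  four-times-minus : + 4 ℤ.* (- p) ≡ + 1
  four-times-minus = trans (rearrange p) (cong (λ z → + 1 ℤ.- z) eq)
    where
    rearrange : ∀ p → + 4 ℤ.* (- p) ≡ + 1 ℤ.- (+ 1 ℤ.+ + 4 ℤ.* p)
    rearrange = solve-∀
  four≡1 : 4 ≡ 1
  four≡1 = ℕP.m*n≡1⇒m≡1 4 ℤ.∣ - p ∣
    (trans (sym (ℤP.abs-* (+ 4) (- p))) (cong ℤ.∣_∣ four-times-minus))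

-- The discriminant of Z_M is -D = 1 + 4p (odd) if D ≡ 3 (mod 4) and -4D
-- otherwise; in both cases it is nonzero for D > 0.
discriminant≢0 : ∀ D → D > 0 → discriminant (ωsq D) ≢ + 0
discriminant≢0 D D>0 with D ℕ.% 4 ℕ.≟ 3
... | yes _ = one-plus-four-times≢0 (- (+ (D ℕ./ 4 ℕ.+ 1)))
... | no _ = minus-four-D≢0 D>0
  where
  minus-four-D≢0 : ∀ {D} → D > 0 → + 0 ℤ.* + 0 ℤ.+ + 4 ℤ.* (- (+ D)) ≢ + 0
  minus-four-D≢0 {suc d} _ eq with ℤP.i*j≡0⇒i≡0∨j≡0 (+ 4) {j = - (+ suc d)} (trans (sym (ℤP.+-identityˡ _)) eq)
  ... | inj₁ ()
  ... | inj₂ ()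

square-zero : ∀ {D} → D > 0 → (x : ZM D) → x *ᴹ x ≡ 0ᴹ → x ≡ 0ᴹ
square-zero {D} D>0 (mk a b) x²≡0 with ωsq D | discriminant≢0 D D>0
... | (p , q) | Δ≢0 = cong₂ mk (proj₁ a≡0×b≡0) (proj₂ a≡0×b≡0)
  where
  a≡0×b≡0 : a ≡ + 0 × b ≡ + 0
  a≡0×b≡0 = square-zero-coordinates p q a b Δ≢0 (cong ZM.re x²≡0) (cong ZM.im x²≡0)

scale-zero : ∀ {D} k (x : ZM D) → k ≢ + 0 → ι k *ᴹ x ≡ 0ᴹ → x ≡ 0ᴹ
scale-zero {D} k (mk a b) k≢0 kx≡0 = cong₂ mk (cancel (cong ZM.re kx≡0′)) (cancel (cong ZM.im kx≡0′))
  where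
  kx≡0′ : mk {D} (k ℤ.* a) (k ℤ.* b) ≡ 0ᴹ
  kx≡0′ = trans (sym (QuadraticRing.ι-scale D k a b)) kx≡0
  cancel : ∀ {z} → k ℤ.* z ≡ + 0 → z ≡ + 0
  cancel kz≡0 = [ (λ k≡0 → contradiction k≡0 k≢0) , id ]′ (ℤP.i*j≡0⇒i≡0∨j≡0 k kz≡0)

modulus-nonzero : ∀ {D} → D > 0 → (c : ZM D) → ¬ (c ≡ 0ᴹ) → ¬ (ι (+ 4) *ᴹ c *ᴹ c ≡ 0ᴹ)
modulus-nonzero {D} D>0 c c≢0 4c²≡0 =
  c≢0 (square-zero D>0 c (scale-zero (+ 4) (c *ᴹ c) (λ ()) 4·c²≡0))
  where
  4·c²≡0 : ι (+ 4) *ᴹ (c *ᴹ c) ≡ 0ᴹ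
  4·c²≡0 = trans (sym (QuadraticRing.*ᴹ-assoc D (ι (+ 4)) c c)) 4c²≡0

triangle : ℕ → ℕ
triangle zero = 0
triangle (suc n) = suc n ℕ.+ triangle n

pronic≡twice-triangle : ∀ n → n ℕ.* suc n ≡ 2 ℕ.* triangle n
pronic≡twice-triangle zero = refl
pronic≡twice-triangle (suc n) = begin
  suc n ℕ.* suc (suc n)              ≡⟨ expand n ⟩
  2 ℕ.* suc n ℕ.+ n ℕ.* suc n        ≡⟨ cong (2 ℕ.* suc n ℕ.+_) (pronic≡twice-triangle n) ⟩
  2 ℕ.* suc n ℕ.+ 2 ℕ.* triangle n   ≡⟨ sym (ℕP.*-distribˡ-+ 2 (suc n) (triangle n)) ⟩
  2 ℕ.* triangle (suc n)             ∎
  where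
  open ≡-Reasoning
  expand : ∀ n → suc n ℕ.* suc (suc n) ≡ 2 ℕ.* suc n ℕ.+ n ℕ.* suc n
  expand = ℕSolver.solve-∀

-- 4. Congruences along second-order linear recurrences

module Congruences (D : ℕ) where
  open QuadraticRing D

  _∣ᴹ_ : ZM D → ZM D → Set
  d ∣ᴹ x = Σ (ZM D) λ q → x ≡ d *ᴹ q

  -- If v_{m+2} = A v_{m+1} - v_m and t_{m+2} - A t_{m+1} + t_m = d e_m, then
  -- w_m = v_m - t_m satisfies w_{m+2} = A w_{m+1} - w_m - d e_m; hence d ∣ w_m
  -- for all m as soon as d ∣ w_0 and d ∣ w_1.
  recurrence-congruence : (d A : ZM D) (v t e : ℕ → ZM D) →
    (∀ m → v (suc (suc m)) ≡ A *ᴹ v (suc m) -ᴹ v m) →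
    (∀ m → t (suc (suc m)) -ᴹ A *ᴹ t (suc m) +ᴹ t m ≡ d *ᴹ e m) →
    d ∣ᴹ (v 0 -ᴹ t 0) → d ∣ᴹ (v 1 -ᴹ t 1) →
    ∀ m → d ∣ᴹ (v m -ᴹ t m)
  recurrence-congruence d A v t e v-rec t-defect w₀ w₁ = w
    where
    regroup : ∀ v₀ v₁ t₀ t₁ t₂ →
      A *ᴹ v₁ -ᴹ v₀ -ᴹ t₂ ≡ A *ᴹ (v₁ -ᴹ t₁) -ᴹ (v₀ -ᴹ t₀) -ᴹ (t₂ -ᴹ A *ᴹ t₁ +ᴹ t₀)
    regroup = solve 6 (λ A v₀ v₁ t₀ t₁ t₂ →
      A :* v₁ :- v₀ :- t₂ := A :* (v₁ :- t₁) :- (v₀ :- t₀) :- (t₂ :- A :* t₁ :+ t₀)) refl A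

    collect : ∀ q₀ q₁ e →
      A *ᴹ (d *ᴹ q₁) -ᴹ d *ᴹ q₀ -ᴹ d *ᴹ e ≡ d *ᴹ (A *ᴹ q₁ -ᴹ q₀ -ᴹ e)
    collect = solve 5 (λ d A q₀ q₁ e →
      A :* (d :* q₁) :- d :* q₀ :- d :* e := d :* (A :* q₁ :- q₀ :- e)) refl d A

    w : ∀ m → d ∣ᴹ (v m -ᴹ t m)
    w zero = w₀
    w (suc zero) = w₁
    w (suc (suc m)) with w m | w (suc m)
    ... | (q₀ , eq₀) | (q₁ , eq₁) = A *ᴹ q₁ -ᴹ q₀ -ᴹ e m , (begin
      v (suc (suc m)) -ᴹ t (suc (suc m))
        ≡⟨ cong (_-ᴹ t (suc (suc m))) (v-rec m) ⟩
      A *ᴹ v (suc m) -ᴹ v m -ᴹ t (suc (suc m))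
        ≡⟨ regroup (v m) (v (suc m)) (t m) (t (suc m)) (t (suc (suc m))) ⟩
      A *ᴹ (v (suc m) -ᴹ t (suc m)) -ᴹ (v m -ᴹ t m)
        -ᴹ (t (suc (suc m)) -ᴹ A *ᴹ t (suc m) +ᴹ t m)
        ≡⟨ cong₂ (λ x y → A *ᴹ x -ᴹ y -ᴹ _) eq₁ eq₀ ⟩
      A *ᴹ (d *ᴹ q₁) -ᴹ d *ᴹ q₀ -ᴹ (t (suc (suc m)) -ᴹ A *ᴹ t (suc m) +ᴹ t m)
        ≡⟨ cong (λ z → A *ᴹ (d *ᴹ q₁) -ᴹ d *ᴹ q₀ -ᴹ z) (t-defect m) ⟩
      A *ᴹ (d *ᴹ q₁) -ᴹ d *ᴹ q₀ -ᴹ d *ᴹ e m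
        ≡⟨ collect q₀ q₁ (e m) ⟩
      d *ᴹ (A *ᴹ q₁ -ᴹ q₀ -ᴹ e m) ∎)
      where open ≡-Reasoning

  -- 5. The targets of Lemma 5.2 nearly satisfy the recurrences of u, u′

  modulus : ZM D → ZM D
  modulus c = ι (+ 4) *ᴹ c *ᴹ c

  ι-pronic : ∀ m → ι {D} (+ (m ℕ.* suc m)) ≡ ι (+ 2) *ᴹ ι (+ triangle m)
  ι-pronic m = begin
    ι (+ (m ℕ.* suc m))              ≡⟨ cong (λ k → ι (+ k)) (pronic≡twice-triangle m) ⟩
    ι (+ (2 ℕ.* triangle m))         ≡⟨ cong ι (ℤP.pos-* 2 (triangle m)) ⟩
    ι (+ 2 ℤ.* + triangle m)         ≡⟨ ι-* (+ 2) (+ triangle m) ⟩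
    ι (+ 2) *ᴹ ι (+ triangle m)      ∎
    where open ≡-Reasoning

  -- The targets ε (1 + m(m+1) c) and (-1)ⁿ ε (1 - n(n+1) c), written with
  -- triangular numbers so that T_{m+1} = (m+1) + T_m holds by computation.
  u-target : ZM D → ZM D → ℕ → ZM D
  u-target ε c m = ε *ᴹ (1ᴹ +ᴹ ι (+ 2) *ᴹ ι (+ triangle m) *ᴹ c)

  u′-target : ZM D → ZM D → ℕ → ZM D
  u′-target ε c n = sgn n *ᴹ ε *ᴹ (1ᴹ -ᴹ ι (+ 2) *ᴹ ι (+ triangle n) *ᴹ c)

  u-target-defect : ∀ ε c m →
    u-target ε c (suc (suc m)) -ᴹ (ι (+ 2) *ᴹ c +ᴹ ι (+ 2)) *ᴹ u-target ε c (suc m)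
      +ᴹ u-target ε c m
    ≡ modulus c *ᴹ (-ᴹ ε *ᴹ ι (+ triangle (suc m)))
  u-target-defect ε c m = solve 4 (λ ε c x T →
      ε :* (con (+ 1) :+ con (+ 2) :* (con (+ 2) :+ x :+ (con (+ 1) :+ x :+ T)) :* c)
        :- (con (+ 2) :* c :+ con (+ 2)) :* (ε :* (con (+ 1) :+ con (+ 2) :* (con (+ 1) :+ x :+ T) :* c))
        :+ ε :* (con (+ 1) :+ con (+ 2) :* T :* c)
      := con (+ 4) :* c :* c :* (:- ε :* (con (+ 1) :+ x :+ T)))
    refl ε c (ι (+ m)) (ι (+ triangle m))

  u′-target-defect : ∀ ε c m →
    u′-target ε c (suc (suc m)) -ᴹ (ι (+ 2) *ᴹ c -ᴹ ι (+ 2)) *ᴹ u′-target ε c (suc m)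
      +ᴹ u′-target ε c m
    ≡ modulus c *ᴹ (-ᴹ sgn m *ᴹ ε *ᴹ ι (+ triangle (suc m)))
  u′-target-defect ε c m = solve 5 (λ ε c s x T →
      :- (:- s) :* ε :* (con (+ 1) :- con (+ 2) :* (con (+ 2) :+ x :+ (con (+ 1) :+ x :+ T)) :* c)
        :- (con (+ 2) :* c :- con (+ 2)) :* (:- s :* ε :* (con (+ 1) :- con (+ 2) :* (con (+ 1) :+ x :+ T) :* c))
        :+ s :* ε :* (con (+ 1) :- con (+ 2) :* T :* c)
      := con (+ 4) :* c :* c :* (:- s :* ε :* (con (+ 1) :+ x :+ T)))
    refl ε c (sgn m) (ι (+ m)) (ι (+ triangle m))

  u-congruence : ∀ ε c m → modulus c ∣ᴹ (u ε c m -ᴹ ε *ᴹ (1ᴹ +ᴹ ι (+ (m ℕ.* suc m)) *ᴹ c))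
  u-congruence ε c m =
    subst (λ P → modulus c ∣ᴹ (u ε c m -ᴹ ε *ᴹ (1ᴹ +ᴹ P *ᴹ c))) (sym (ι-pronic m))
      (recurrence-congruence (modulus c) (ι (+ 2) *ᴹ c +ᴹ ι (+ 2)) (u ε c) (u-target ε c)
        (λ m → -ᴹ ε *ᴹ ι (+ triangle (suc m))) (λ _ → refl) (u-target-defect ε c)
        (0ᴹ , initial₀) (0ᴹ , initial₁) m)
    where
    initial₀ : u ε c 0 -ᴹ u-target ε c 0 ≡ modulus c *ᴹ 0ᴹ
    initial₀ = solve 2 (λ ε c →
      ε :- ε :* (con (+ 1) :+ con (+ 2) :* con (+ 0) :* c) := con (+ 4) :* c :* c :* con (+ 0))
      refl ε c
    initial₁ : u ε c 1 -ᴹ u-target ε c 1 ≡ modulus c *ᴹ 0ᴹ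
    initial₁ = solve 2 (λ ε c →
      ε :* (con (+ 2) :* c :+ con (+ 1)) :- ε :* (con (+ 1) :+ con (+ 2) :* con (+ 1) :* c)
      := con (+ 4) :* c :* c :* con (+ 0))
      refl ε c

  u′-congruence : ∀ ε c n →
    modulus c ∣ᴹ (u′ ε c n -ᴹ sgn n *ᴹ ε *ᴹ (1ᴹ -ᴹ ι (+ (n ℕ.* suc n)) *ᴹ c))
  u′-congruence ε c n =
    subst (λ P → modulus c ∣ᴹ (u′ ε c n -ᴹ sgn n *ᴹ ε *ᴹ (1ᴹ -ᴹ P *ᴹ c))) (sym (ι-pronic n))
      (recurrence-congruence (modulus c) (ι (+ 2) *ᴹ c -ᴹ ι (+ 2)) (u′ ε c) (u′-target ε c)
        (λ m → -ᴹ sgn m *ᴹ ε *ᴹ ι (+ triangle (suc m))) (λ _ → refl) (u′-target-defect ε c)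
        (0ᴹ , initial₀) (0ᴹ , initial₁) n)
    where
    initial₀ : u′ ε c 0 -ᴹ u′-target ε c 0 ≡ modulus c *ᴹ 0ᴹ
    initial₀ = solve 2 (λ ε c →
      ε :- con (+ 1) :* ε :* (con (+ 1) :- con (+ 2) :* con (+ 0) :* c)
      := con (+ 4) :* c :* c :* con (+ 0))
      refl ε c
    initial₁ : u′ ε c 1 -ᴹ u′-target ε c 1 ≡ modulus c *ᴹ 0ᴹ
    initial₁ = solve 2 (λ ε c →
      ε :* (con (+ 2) :* c :- con (+ 1)) :- (:- con (+ 1)) :* ε :* (con (+ 1) :- con (+ 2) :* con (+ 1) :* c)
      := con (+ 4) :* c :* c :* con (+ 0))
      refl ε c

lemma5p2 : (D : ℕ) → D > 0 → SquareFree D →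
           (c ε : ZM D) → ¬ (c ≡ 0ᴹ) → IsUnit ε →
           (m n : ℕ) →
           (u ε c m ≡ ε *ᴹ (1ᴹ +ᴹ ι (+ (m Data.Nat.* suc m)) *ᴹ c) [mod ι (+ 4) *ᴹ c *ᴹ c ])
           × (u′ ε c n ≡ sgn n *ᴹ ε *ᴹ (1ᴹ -ᴹ ι (+ (n Data.Nat.* suc n)) *ᴹ c) [mod ι (+ 4) *ᴹ c *ᴹ c ])
lemma5p2 D D>0 _ c ε c≢0 _ m n =
  (4c²≢0 , u-congruence ε c m) , (4c²≢0 , u′-congruence ε c n)
  where
  open Congruences D
  4c²≢0 : ¬ (modulus c ≡ 0ᴹ)
  4c²≢0 = modulus-nonzero D>0 c c≢0
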